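{- Let $n,m,k$ be positive integers with $1\le k\le n-1$, and let $B$ be a bipartite graph with $n$ vertices and $m$ edges, having a bipartition $(X,Y)$ with $|X|=k$. Let $\overline{B}$ be the bipartite graph on the same vertex set and the same bipartition $(X,Y)$ in which $x\in X$ and $y\in Y$ are adjacent if and only if they are not adjacent in $B$ (so $\overline B$ has $k(n-k)-m$ edges). Then $\sigma_2(B)$ attains the maximum value of $\sigma_2$ over all graphs in $\mathscr{B}(n,m,k)$ if and only if $\sigma_2(\overline{B})$ attains the maximum value of $\sigma_2$ over all graphs in $\mathscr{B}(n,k(n-k)-m,k)$.
   Context: All graphs are finite, simple and undirected. For a graph $G$, $\sigma_2(G)=\sum_{v\in V(G)} d(v)^2$, where $d(v)$ is the degree of $v$. $\mathscr{B}(n,m,k)$ denotes the set of bipartite graphs with $n$ vertices and $m$ edges having a bipartition $(X,Y)$ with $|X|=k$. -}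

module Defs where

open import Data.Nat using (ℕ; zero; suc; _+_; _*_; _^_; _<_; _≤_)
open import Data.Nat.Properties using (_<?_)
open import Data.Fin using (Fin; toℕ)
open import Data.List using (List; map)
open import Data.Nat.ListAction using (sum)
open import Data.Bool using (Bool; true; false; if_then_else_; not; _∧_; _xor_)
open import Data.Product using (Σ; _×_; ∃)
open import Data.Empty using (⊥)
open import Relation.Nullary using (¬_; does)
open import Relation.Binary.PropositionalEquality using (_≡_; _≢_)
open import Data.List using (allFin)

Adj : ℕ → Set
Adj n = Fin n → Fin n → Bool

IsSimple : ∀ {n} → Adj n → Set
IsSimple {n} G = (∀ i j → G i j ≡ G j i) × (∀ i → G i i ≡ false)

Σfin : ∀ n → (Fin n → ℕ) → ℕ
Σfin n f = sum (map f (allFin n))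

b2n : Bool → ℕ
b2n true = 1
b2n false = 0

degree : ∀ {n} → Adj n → Fin n → ℕ
degree {n} G v = Σfin n (λ j → b2n (G v j))

σ₂ : ∀ {n} → Adj n → ℕ
σ₂ {n} G = Σfin n (λ v → degree G v ^ 2)

edges : ∀ {n} → Adj n → ℕ
edges {n} G = Σfin n (λ i → Σfin n (λ j →
  if does (toℕ i <? toℕ j) then b2n (G i j) else 0))

-- a subset X ⊆ Fin n (Y is its complement)
size : ∀ {n} → (Fin n → Bool) → ℕ
size {n} X = Σfin n (λ i → b2n (X i))

IsBipartition : ∀ {n} → Adj n → (Fin n → Bool) → Set
IsBipartition G X = ∀ i j → G i j ≡ true → X i ≢ X j

InB : ∀ n → ℕ → ℕ → Adj n → Set
InB n m k G = IsSimple G × edges G ≡ m ×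
  ∃ (λ (X : Fin n → Bool) → IsBipartition G X × size X ≡ k)

IsMaxσ₂ : ∀ n → ℕ → ℕ → Adj n → Set
IsMaxσ₂ n m k G = InB n m k G × (∀ (H : Adj n) → InB n m k H → σ₂ H ≤ σ₂ G)

bipComp : ∀ {n} → Adj n → (Fin n → Bool) → Adj n
bipComp G X i j = (X i xor X j) ∧ not (G i j)

-- For a graph H that is bipartite with respect to X, let c v be the size of the side of the
-- bipartition opposite to v, i.e. the degree of v in the complete bipartite graph on (X, V∖X).
-- Then d_H v + d_Hᶜ v = c v for the bipartite complement Hᶜ, and c u + c v = n across every edge,
-- so Σ_v c v · d_G v = n · e(G) for every G bipartite with respect to X. Summing the identity
-- d² + c·dᶜ = dᶜ² + c·d (where c = d + dᶜ) over all vertices gives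
--   σ₂(H) + n·e(Hᶜ) = σ₂(Hᶜ) + n·e(H),
-- and e(H) + e(Hᶜ) = k(n−k). Hence σ₂(Hᶜ) − σ₂(H) depends only on n, k and e(H), and
-- complementation maps 𝓑(n,m,k) into 𝓑(n,k(n−k)−m,k) and back, so maximisers correspond.

module Submission where

open import Defs
open import Data.Nat using (ℕ; zero; suc; _+_; _*_; _∸_; _^_; _≤_; _<_)
open import Data.Nat.Properties
open import Data.Nat.Tactic.RingSolver using (solve-∀)
open import Data.Fin using (Fin; toℕ) renaming (zero to fzero; suc to fsuc)
open import Data.Fin.Properties using (toℕ-injective)
open import Data.Bool using (Bool; true; false; not; _∧_; _xor_; if_then_else_)
open import Data.Bool.Properties using (¬-not; xor-comm; xor-same; xor-inverseˡ; ∧-identityʳ)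
open import Data.List using (tabulate)
open import Data.List.Properties using (map-tabulate)
import Data.Nat.ListAction as List
open import Data.Product using (_,_; proj₁)
open import Algebra.Properties.Semiring.Sum +-*-semiring
open import Algebra.Properties.CommutativeSemigroup *-commutativeSemigroup using (x∙yz≈y∙xz)
open import Relation.Binary.Definitions using (tri<; tri≈; tri>)
open import Relation.Nullary using (does; ¬_; contradiction)
open import Relation.Nullary.Decidable using (dec-true; dec-false)
open import Relation.Binary.PropositionalEquality
open import Function using (id)
open import Function.Bundles using (_⇔_; mk⇔)

sum-tabulate : ∀ {n} (f : Fin n → ℕ) → List.sum (tabulate f) ≡ ∑[ i < n ] f i
sum-tabulate {zero}  f = refl
sum-tabulate {suc n} f = cong (f fzero +_) (sum-tabulate (λ i → f (fsuc i)))

Σfin≡∑ : ∀ n (f : Fin n → ℕ) → Σfin n f ≡ ∑[ i < n ] f i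
Σfin≡∑ n f = trans (cong List.sum (map-tabulate id f)) (sum-tabulate f)

∑-one : ∀ n → ∑[ i < n ] 1 ≡ n
∑-one zero    = refl
∑-one (suc n) = cong suc (∑-one n)

∑∑-* : ∀ {m n} (f : Fin m → ℕ) (g : Fin n → ℕ) →
  ∑[ i < m ] ∑[ j < n ] (f i * g j) ≡ (∑[ i < m ] f i) * (∑[ j < n ] g j)
∑∑-* f g = begin
  ∑[ i < _ ] ∑[ j < _ ] (f i * g j)  ≡⟨ sum-cong-≗ (λ i → *-distribˡ-sum (f i) g) ⟨
  ∑[ i < _ ] (f i * sum g)           ≡⟨ *-distribʳ-sum (sum g) f ⟨
  sum f * sum g                      ∎
  where open ≡-Reasoning

Symmetric : ∀ {n} → (Fin n → Fin n → ℕ) → Set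
Symmetric f = ∀ i j → f i j ≡ f j i

upper : ∀ {n} → (Fin n → Fin n → ℕ) → Fin n → Fin n → ℕ
upper f i j = if does (toℕ i <? toℕ j) then f i j else 0

upper-< : ∀ {n} (f : Fin n → Fin n → ℕ) {i j} → toℕ i < toℕ j → upper f i j ≡ f i j
upper-< f {i} {j} i<j rewrite dec-true (toℕ i <? toℕ j) i<j = refl

upper-≮ : ∀ {n} (f : Fin n → Fin n → ℕ) {i j} → ¬ toℕ i < toℕ j → upper f i j ≡ 0
upper-≮ f {i} {j} i≮j rewrite dec-false (toℕ i <? toℕ j) i≮j = refl

upper-split : ∀ {n} (f : Fin n → Fin n → ℕ) → Symmetric f → (∀ i → f i i ≡ 0) →
  ∀ i j → f i j ≡ upper f i j + upper f j i
upper-split f sym-f diag-f i j with <-cmp (toℕ i) (toℕ j)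
... | tri< i<j _ j≮i =
  sym (trans (cong₂ _+_ (upper-< f {i} {j} i<j) (upper-≮ f {j} {i} j≮i)) (+-identityʳ _))
... | tri> i≮j _ j<i =
  trans (sym-f i j) (sym (cong₂ _+_ (upper-≮ f {i} {j} i≮j) (upper-< f {j} {i} j<i)))
... | tri≈ i≮i i≡j _ rewrite toℕ-injective i≡j =
  trans (diag-f j) (sym (cong₂ _+_ (upper-≮ f {j} {j} i≮i) (upper-≮ f {j} {j} i≮i)))

∑∑-upper : ∀ {n} (f : Fin n → Fin n → ℕ) → Symmetric f → (∀ i → f i i ≡ 0) →
  ∑[ i < n ] ∑[ j < n ] f i j ≡ 2 * ∑[ i < n ] ∑[ j < n ] upper f i j
∑∑-upper {n} f sym-f diag-f = begin
  ∑[ i < n ] ∑[ j < n ] f i j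
    ≡⟨ sum-cong-≗ (λ i → sum-cong-≗ (upper-split f sym-f diag-f i)) ⟩
  ∑[ i < n ] ∑[ j < n ] (upper f i j + upper f j i)
    ≡⟨ sum-cong-≗ (λ i → ∑-distrib-+ (upper f i) (λ j → upper f j i)) ⟩
  ∑[ i < n ] (∑[ j < n ] upper f i j + ∑[ j < n ] upper f j i)
    ≡⟨ ∑-distrib-+ (λ i → ∑[ j < n ] upper f i j) (λ i → ∑[ j < n ] upper f j i) ⟩
  U + ∑[ i < n ] ∑[ j < n ] upper f j i
    ≡⟨ cong (U +_) (∑-comm (λ i j → upper f j i)) ⟩
  U + U
    ≡⟨ cong (U +_) (+-identityʳ U) ⟨
  2 * U
    ∎
  where
  open ≡-Reasoning
  U = ∑[ i < n ] ∑[ j < n ] upper f i j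

∑-weighted-symmetric : ∀ {n} (w : Fin n → ℕ) (A : Fin n → Fin n → ℕ) → Symmetric A →
  ∑[ i < n ] ∑[ j < n ] ((w i + w j) * A i j) ≡ 2 * ∑[ i < n ] (w i * ∑[ j < n ] A i j)
∑-weighted-symmetric {n} w A sym-A = begin
  ∑[ i < n ] ∑[ j < n ] ((w i + w j) * A i j)
    ≡⟨ sum-cong-≗ (λ i → sum-cong-≗ (λ j → *-distribʳ-+ (A i j) (w i) (w j))) ⟩
  ∑[ i < n ] ∑[ j < n ] (w i * A i j + w j * A i j)
    ≡⟨ sum-cong-≗ (λ i → ∑-distrib-+ (λ j → w i * A i j) (λ j → w j * A i j)) ⟩
  ∑[ i < n ] (∑[ j < n ] (w i * A i j) + ∑[ j < n ] (w j * A i j))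
    ≡⟨ ∑-distrib-+ (λ i → ∑[ j < n ] (w i * A i j)) (λ i → ∑[ j < n ] (w j * A i j)) ⟩
  V + ∑[ i < n ] ∑[ j < n ] (w j * A i j)
    ≡⟨ cong (V +_) (∑-comm (λ i j → w j * A i j)) ⟩
  V + ∑[ j < n ] ∑[ i < n ] (w j * A i j)
    ≡⟨ cong (V +_) (sum-cong-≗ (λ j → sum-cong-≗ (λ i → cong (w j *_) (sym-A i j)))) ⟩
  V + V
    ≡⟨ cong (V +_) (+-identityʳ V) ⟨
  2 * V
    ≡⟨ cong (2 *_) (sum-cong-≗ (λ i → *-distribˡ-sum (w i) (A i))) ⟨
  2 * ∑[ i < n ] (w i * ∑[ j < n ] A i j)
    ∎
  where
  open ≡-Reasoning
  V = ∑[ i < n ] ∑[ j < n ] (w i * A i j)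

adj : ∀ {n} → Adj n → Fin n → Fin n → ℕ
adj G i j = b2n (G i j)

degree≡∑ : ∀ {n} (G : Adj n) v → degree G v ≡ ∑[ j < n ] adj G v j
degree≡∑ {n} G v = Σfin≡∑ n (adj G v)

edges≡∑∑ : ∀ {n} (G : Adj n) → edges G ≡ ∑[ i < n ] ∑[ j < n ] upper (adj G) i j
edges≡∑∑ {n} G = trans (Σfin≡∑ n _) (sum-cong-≗ {n} (λ i → Σfin≡∑ n (upper (adj G) i)))

handshake : ∀ {n} (G : Adj n) → IsSimple G → ∑[ v < n ] degree G v ≡ 2 * edges G
handshake {n} G (sym-G , loopless-G) = begin
  ∑[ v < n ] degree G v                       ≡⟨ sum-cong-≗ (degree≡∑ G) ⟩
  ∑[ i < n ] ∑[ j < n ] adj G i j             ≡⟨ ∑∑-upper (adj G) (λ i j → cong b2n (sym-G i j))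
                                                              (λ i → cong b2n (loopless-G i)) ⟩
  2 * ∑[ i < n ] ∑[ j < n ] upper (adj G) i j ≡⟨ cong (2 *_) (edges≡∑∑ G) ⟨
  2 * edges G                                 ∎
  where open ≡-Reasoning

completeBipartite : ∀ {n} → (Fin n → Bool) → Adj n
completeBipartite X i j = X i xor X j

b2n-xor-not : ∀ x z → b2n (x xor z) + b2n (not x xor z) ≡ 1
b2n-xor-not true  true  = refl
b2n-xor-not true  false = refl
b2n-xor-not false true  = refl
b2n-xor-not false false = refl

b2n-not : ∀ x → b2n x + b2n (not x) ≡ 1
b2n-not true  = refl
b2n-not false = refl

b2n-xor : ∀ x y → b2n (x xor y) ≡ b2n x * b2n (not y) + b2n (not x) * b2n y
b2n-xor true  true  = refl
b2n-xor true  false = refl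
b2n-xor false true  = refl
b2n-xor false false = refl

module _ {n} (X : Fin n → Bool) where

  private
    K : Adj n
    K = completeBipartite X

  degree-completeBipartite-+ : ∀ {i j} → X i ≢ X j → degree K i + degree K j ≡ n
  degree-completeBipartite-+ {i} {j} Xi≢Xj = begin
    degree K i + degree K j
      ≡⟨ cong₂ _+_ (degree≡∑ K i) (degree≡∑ K j) ⟩
    ∑[ l < n ] adj K i l + ∑[ l < n ] adj K j l
      ≡⟨ ∑-distrib-+ (adj K i) (adj K j) ⟨
    ∑[ l < n ] (adj K i l + adj K j l)
      ≡⟨ sum-cong-≗ other-side ⟩
    ∑[ l < n ] (b2n (X i xor X l) + b2n (not (X i) xor X l))
      ≡⟨ sum-cong-≗ (λ l → b2n-xor-not (X i) (X l)) ⟩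
    ∑[ l < n ] 1
      ≡⟨ ∑-one n ⟩
    n ∎
    where
    open ≡-Reasoning
    other-side : ∀ l → adj K i l + adj K j l ≡ b2n (X i xor X l) + b2n (not (X i) xor X l)
    other-side l = cong (λ y → adj K i l + b2n (y xor X l)) (¬-not (λ e → Xi≢Xj (sym e)))

  ∑-not≡n∸size : ∑[ i < n ] b2n (not (X i)) ≡ n ∸ size X
  ∑-not≡n∸size = begin
    ∑[ i < n ] b2n (not (X i))                   ≡⟨ m+n∸m≡n (size X) _ ⟨
    size X + ∑[ i < n ] b2n (not (X i)) ∸ size X ≡⟨ cong (_∸ size X) partition ⟩
    n ∸ size X                                   ∎
    where
    open ≡-Reasoning
    partition : size X + ∑[ i < n ] b2n (not (X i)) ≡ n
    partition = begin
      size X + ∑[ i < n ] b2n (not (X i))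
        ≡⟨ cong (_+ ∑[ i < n ] b2n (not (X i))) (Σfin≡∑ n (λ i → b2n (X i))) ⟩
      ∑[ i < n ] b2n (X i) + ∑[ i < n ] b2n (not (X i))
        ≡⟨ ∑-distrib-+ (λ i → b2n (X i)) (λ i → b2n (not (X i))) ⟨
      ∑[ i < n ] (b2n (X i) + b2n (not (X i)))
        ≡⟨ sum-cong-≗ (λ i → b2n-not (X i)) ⟩
      ∑[ i < n ] 1
        ≡⟨ ∑-one n ⟩
      n ∎

  ∑-degree-completeBipartite : ∑[ v < n ] degree K v ≡ 2 * (size X * (n ∸ size X))
  ∑-degree-completeBipartite = begin
    ∑[ v < n ] degree K v
      ≡⟨ sum-cong-≗ (λ i → trans (degree≡∑ K i) (sum-cong-≗ (λ j → b2n-xor (X i) (X j)))) ⟩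
    ∑[ i < n ] ∑[ j < n ] (inX i * inY j + inY i * inX j)
      ≡⟨ sum-cong-≗ (λ i → ∑-distrib-+ (λ j → inX i * inY j) (λ j → inY i * inX j)) ⟩
    ∑[ i < n ] (∑[ j < n ] (inX i * inY j) + ∑[ j < n ] (inY i * inX j))
      ≡⟨ ∑-distrib-+ (λ i → ∑[ j < n ] (inX i * inY j)) (λ i → ∑[ j < n ] (inY i * inX j)) ⟩
    ∑[ i < n ] ∑[ j < n ] (inX i * inY j) + ∑[ i < n ] ∑[ j < n ] (inY i * inX j)
      ≡⟨ cong₂ _+_ (∑∑-* inX inY) (∑∑-* inY inX) ⟩
    sum inX * sum inY + sum inY * sum inX
      ≡⟨ cong₂ (λ a b → a * b + b * a) (sym (Σfin≡∑ n inX)) ∑-not≡n∸size ⟩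
    size X * (n ∸ size X) + (n ∸ size X) * size X
      ≡⟨ double (size X) (n ∸ size X) ⟩
    2 * (size X * (n ∸ size X)) ∎
    where
    open ≡-Reasoning
    inX inY : Fin n → ℕ
    inX i = b2n (X i)
    inY i = b2n (not (X i))
    double : ∀ a b → a * b + b * a ≡ 2 * (a * b)
    double = solve-∀

  ∑-degree-weighted : ∀ (G : Adj n) → IsSimple G → IsBipartition G X →
    ∑[ v < n ] (degree K v * degree G v) ≡ n * edges G
  ∑-degree-weighted G simple-G bipartite-G = *-cancelˡ-≡ _ _ 2 (begin
    2 * ∑[ v < n ] (degree K v * degree G v)
      ≡⟨ cong (2 *_) (sum-cong-≗ (λ v → cong (degree K v *_) (degree≡∑ G v))) ⟩
    2 * ∑[ i < n ] (degree K i * ∑[ j < n ] adj G i j)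
      ≡⟨ ∑-weighted-symmetric (degree K) (adj G) (λ i j → cong b2n (proj₁ simple-G i j)) ⟨
    ∑[ i < n ] ∑[ j < n ] ((degree K i + degree K j) * adj G i j)
      ≡⟨ sum-cong-≗ (λ i → sum-cong-≗ (weight-across i)) ⟩
    ∑[ i < n ] ∑[ j < n ] (n * adj G i j)
      ≡⟨ sum-cong-≗ (λ i → trans (cong (n *_) (degree≡∑ G i)) (*-distribˡ-sum n (adj G i))) ⟨
    ∑[ i < n ] (n * degree G i)
      ≡⟨ *-distribˡ-sum n (degree G) ⟨
    n * ∑[ i < n ] degree G i
      ≡⟨ cong (n *_) (handshake G simple-G) ⟩
    n * (2 * edges G)
      ≡⟨ x∙yz≈y∙xz n 2 (edges G) ⟩
    2 * (n * edges G) ∎)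
    where
    open ≡-Reasoning
    weight-across : ∀ i j → (degree K i + degree K j) * adj G i j ≡ n * adj G i j
    weight-across i j with G i j in Gij
    ... | true  = cong (_* 1) (degree-completeBipartite-+ (bipartite-G i j Gij))
    ... | false = trans (*-zeroʳ (degree K i + degree K j)) (sym (*-zeroʳ n))

module _ {n} {H : Adj n} {X : Fin n → Bool} (simple-H : IsSimple H) (bipartite-H : IsBipartition H X) where

  private
    K : Adj n
    K = completeBipartite X
    Hᶜ : Adj n
    Hᶜ = bipComp H X

  bipComp-simple : IsSimple Hᶜ
  bipComp-simple = (λ i j → cong₂ _∧_ (xor-comm (X i) (X j)) (cong not (proj₁ simple-H i j)))
                 , (λ i → cong (_∧ not (H i i)) (xor-same (X i)))

  bipComp-bipartite : IsBipartition Hᶜ X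
  bipComp-bipartite i j Hᶜij Xi≡Xj = contradiction (trans (sym Hᶜij) sameSide) λ ()
    where
    sameSide : Hᶜ i j ≡ false
    sameSide = trans (cong (λ x → (X i xor x) ∧ not (H i j)) (sym Xi≡Xj))
                     (cong (_∧ not (H i j)) (xor-same (X i)))

  adj-bipComp : ∀ i j → adj H i j + adj Hᶜ i j ≡ adj K i j
  adj-bipComp i j with H i j in Hij
  ... | true  rewrite ¬-not (bipartite-H i j Hij) | xor-inverseˡ (X j) = refl
  ... | false = cong b2n (∧-identityʳ (X i xor X j))

  degree-bipComp : ∀ v → degree H v + degree Hᶜ v ≡ degree K v
  degree-bipComp v = begin
    degree H v + degree Hᶜ v                     ≡⟨ cong₂ _+_ (degree≡∑ H v) (degree≡∑ Hᶜ v) ⟩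
    ∑[ j < n ] adj H v j + ∑[ j < n ] adj Hᶜ v j ≡⟨ ∑-distrib-+ (adj H v) (adj Hᶜ v) ⟨
    ∑[ j < n ] (adj H v j + adj Hᶜ v j)          ≡⟨ sum-cong-≗ (adj-bipComp v) ⟩
    ∑[ j < n ] adj K v j                          ≡⟨ degree≡∑ K v ⟨
    degree K v                                    ∎
    where open ≡-Reasoning

  edges-bipComp-+ : edges H + edges Hᶜ ≡ size X * (n ∸ size X)
  edges-bipComp-+ = *-cancelˡ-≡ _ _ 2 (begin
    2 * (edges H + edges Hᶜ)
      ≡⟨ *-distribˡ-+ 2 (edges H) (edges Hᶜ) ⟩
    2 * edges H + 2 * edges Hᶜ
      ≡⟨ cong₂ _+_ (handshake H simple-H) (handshake Hᶜ bipComp-simple) ⟨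
    ∑[ v < n ] degree H v + ∑[ v < n ] degree Hᶜ v
      ≡⟨ ∑-distrib-+ (degree H) (degree Hᶜ) ⟨
    ∑[ v < n ] (degree H v + degree Hᶜ v)
      ≡⟨ sum-cong-≗ degree-bipComp ⟩
    ∑[ v < n ] degree K v
      ≡⟨ ∑-degree-completeBipartite X ⟩
    2 * (size X * (n ∸ size X)) ∎)
    where open ≡-Reasoning

  σ₂-bipComp-balance : σ₂ H + n * edges Hᶜ ≡ σ₂ Hᶜ + n * edges H
  σ₂-bipComp-balance = begin
    σ₂ H + n * edges Hᶜ
      ≡⟨ cong₂ _+_ (sym (Σfin≡∑ n (λ v → d v ^ 2))) (∑-degree-weighted X Hᶜ bipComp-simple bipComp-bipartite) ⟨
    ∑[ v < n ] (d v ^ 2) + ∑[ v < n ] (c v * dᶜ v)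
      ≡⟨ ∑-distrib-+ (λ v → d v ^ 2) (λ v → c v * dᶜ v) ⟨
    ∑[ v < n ] (d v ^ 2 + c v * dᶜ v)
      ≡⟨ sum-cong-≗ pointwise ⟩
    ∑[ v < n ] (dᶜ v ^ 2 + c v * d v)
      ≡⟨ ∑-distrib-+ (λ v → dᶜ v ^ 2) (λ v → c v * d v) ⟩
    ∑[ v < n ] (dᶜ v ^ 2) + ∑[ v < n ] (c v * d v)
      ≡⟨ cong₂ _+_ (sym (Σfin≡∑ n (λ v → dᶜ v ^ 2))) (∑-degree-weighted X H simple-H bipartite-H) ⟩
    σ₂ Hᶜ + n * edges H ∎
    where
    open ≡-Reasoning
    d dᶜ c : Fin n → ℕ
    d  = degree H
    dᶜ = degree Hᶜ
    c  = degree K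
    -- a ^ 2 unfolds to a * (a * 1); the ring solver does not accept _^_ here.
    swap : ∀ a b → a * (a * 1) + (a + b) * b ≡ b * (b * 1) + (a + b) * a
    swap = solve-∀
    pointwise : ∀ v → d v ^ 2 + c v * dᶜ v ≡ dᶜ v ^ 2 + c v * d v
    pointwise v rewrite sym (degree-bipComp v) = swap (d v) (dᶜ v)

edges-bipComp : ∀ {n eᶜ} {H : Adj n} {X : Fin n → Bool} → IsSimple H → IsBipartition H X →
  edges H + eᶜ ≡ size X * (n ∸ size X) → edges (bipComp H X) ≡ eᶜ
edges-bipComp {H = H} simple-H bipartite-H total =
  +-cancelˡ-≡ (edges H) _ _ (trans (edges-bipComp-+ simple-H bipartite-H) (sym total))

bipComp-InB : ∀ {n k e eᶜ} {H : Adj n} {X : Fin n → Bool} → IsSimple H → IsBipartition H X →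
  size X ≡ k → edges H ≡ e → e + eᶜ ≡ k * (n ∸ k) → InB n eᶜ k (bipComp H X)
bipComp-InB {X = X} simple-H bipartite-H refl refl total =
  bipComp-simple simple-H bipartite-H , edges-bipComp simple-H bipartite-H total ,
  X , bipComp-bipartite simple-H bipartite-H , refl

σ₂-bipComp : ∀ {n k e eᶜ} {H : Adj n} {X : Fin n → Bool} → IsSimple H → IsBipartition H X →
  size X ≡ k → edges H ≡ e → e + eᶜ ≡ k * (n ∸ k) → σ₂ H + n * eᶜ ≡ σ₂ (bipComp H X) + n * e
σ₂-bipComp simple-H bipartite-H refl refl total
  rewrite sym (edges-bipComp simple-H bipartite-H total) = σ₂-bipComp-balance simple-H bipartite-H

≤-transfer : ∀ {x x′ y y′ c d} → x + c ≡ y + d → x′ + c ≡ y′ + d → y ≤ y′ → x ≤ x′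
≤-transfer {x} {x′} {y} {y′} {c} {d} balance balance′ y≤y′ = +-cancelʳ-≤ c x x′ (begin
  x + c  ≡⟨ balance ⟩
  y + d  ≤⟨ +-monoˡ-≤ d y≤y′ ⟩
  y′ + d ≡⟨ balance′ ⟨
  x′ + c ∎)
  where open ≤-Reasoning

lemma4 : (n m k : ℕ) → 1 ≤ n → 1 ≤ m → 1 ≤ k → k < n →
    (B : Adj n) → IsSimple B → edges B ≡ m →
    (X : Fin n → Bool) → IsBipartition B X → size X ≡ k →
    IsMaxσ₂ n m k B ⇔ IsMaxσ₂ n (k * (n ∸ k) ∸ m) k (bipComp B X)
lemma4 n m k _ _ _ _ B simple-B edges-B X bipartite-B size-X = mk⇔ to from
  where
  K : ℕ
  K = k * (n ∸ k)
  m≤K : m ≤ K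
  m≤K = subst₂ (λ e s → e ≤ s * (n ∸ s)) edges-B size-X
          (subst (edges B ≤_) (edges-bipComp-+ simple-B bipartite-B) (m≤m+n _ _))
  m+mᶜ : m + (K ∸ m) ≡ K
  m+mᶜ = m+[n∸m]≡n m≤K
  mᶜ+m : (K ∸ m) + m ≡ K
  mᶜ+m = m∸n+n≡m m≤K

  to : IsMaxσ₂ n m k B → IsMaxσ₂ n (K ∸ m) k (bipComp B X)
  to (_ , B-max) = bipComp-InB simple-B bipartite-B size-X edges-B m+mᶜ , λ where
    H (simple-H , edges-H , Y , bipartite-H , size-Y) →
      ≤-transfer (σ₂-bipComp simple-H bipartite-H size-Y edges-H mᶜ+m)
                 (sym (σ₂-bipComp simple-B bipartite-B size-X edges-B m+mᶜ))
                 (B-max (bipComp H Y) (bipComp-InB simple-H bipartite-H size-Y edges-H mᶜ+m))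

  from : IsMaxσ₂ n (K ∸ m) k (bipComp B X) → IsMaxσ₂ n m k B
  from (_ , Bᶜ-max) = (simple-B , edges-B , X , bipartite-B , size-X) , λ where
    H (simple-H , edges-H , Y , bipartite-H , size-Y) →
      ≤-transfer (σ₂-bipComp simple-H bipartite-H size-Y edges-H m+mᶜ)
                 (σ₂-bipComp simple-B bipartite-B size-X edges-B m+mᶜ)
                 (Bᶜ-max (bipComp H Y) (bipComp-InB simple-H bipartite-H size-Y edges-H m+mᶜ))
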